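{- Let $r\in\mathbb{N}$. Every $r$-regular digraph $D$ satisfies $\mathrm{dtw}(D)\ge\left\lfloor\frac{r}{20}\right\rfloor$.
   Context: Digraphs are finite, have no loops and no parallel arcs (antiparallel arcs allowed). A digraph is $r$-regular if every vertex has out-degree and in-degree exactly $r$. Directed tree-width (Johnson, Robertson, Seymour, Thomas): for $X\subseteq V(D)$, a set $Z\subseteq V(D)\setminus X$ is $X$-normal if there is no directed walk in $D-X$ whose first and last vertices lie in $Z$ and which contains a vertex not in $Z$. An arborescence is a directed tree $R$ with a root $r_0$ such that every vertex of $R$ is reachable from $r_0$ by a directed path. An arboreal decomposition of $D$ is a triple $(R,(X_e)_{e\in A(R)},(W_t)_{t\in V(R)})$ where $R$ is an arborescence, the $W_t$ are nonempty, pairwise disjoint sets with union $V(D)$, each $X_e\subseteq V(D)$, and for every arc $e=(s,t)$ of $R$ the set $\bigcup\{W_u: u \text{ reachable from } t \text{ in } R\}$ is $X_e$-normal. Its width is $\max_{t\in V(R)}\left|W_t\cup\bigcup_{e\text{ incident with }t}X_e\right|-1$. The directed tree-width $\mathrm{dtw}(D)$ is the minimum width of an arboreal decomposition of $D$. -}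

module Defs where

open import Data.Nat using (ℕ; _∸_; _⊔_)
import Data.Nat
open import Data.Bool using (Bool; true; false; if_then_else_)
open import Data.Fin using (Fin)
open import Data.Fin.Subset using (Subset; _∈_; _∉_; _∪_; ⋃; ∣_∣; ⊥; Nonempty)
open import Data.List using (List; []; _∷_; [_]; last; map; foldr; allFin)
open import Data.List.Relation.Unary.All using (All)
open import Data.List.Relation.Unary.Any using (Any)
open import Data.Vec using (tabulate)
open import Data.Maybe using (just)
open import Data.Product using (Σ; _×_; ∃; ∃-syntax)
open import Relation.Binary.PropositionalEquality using (_≡_; _≢_)
open import Relation.Nullary using (¬_)

-- Digraphs on vertex set Fin n, given by a Boolean adjacency relation
-- (so there are no parallel arcs); no loops; antiparallel arcs allowed.

record Digraph : Set where
  field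
    n       : ℕ
    arc     : Fin n → Fin n → Bool
    loopless : ∀ v → arc v v ≡ false
open Digraph public

outdeg : (D : Digraph) → Fin (n D) → ℕ
outdeg D v = ∣ tabulate (λ w → arc D v w) ∣

indeg : (D : Digraph) → Fin (n D) → ℕ
indeg D v = ∣ tabulate (λ u → arc D u v) ∣

Regular : ℕ → Digraph → Set
Regular r D = ∀ v → outdeg D v ≡ r × indeg D v ≡ r

data IsWalk {m : ℕ} (A : Fin m → Fin m → Bool) : List (Fin m) → Set where
  single : ∀ v → IsWalk A [ v ]
  cons   : ∀ u v vs → A u v ≡ true → IsWalk A (v ∷ vs) → IsWalk A (u ∷ v ∷ vs)

Reachable : {m : ℕ} → (Fin m → Fin m → Bool) → Fin m → Fin m → Set
Reachable A u v = ∃[ vs ] (IsWalk A (u ∷ vs) × last (u ∷ vs) ≡ just v)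

Normal : (D : Digraph) → Subset (n D) → (Fin (n D) → Set) → Set
Normal D X Z =
  (∀ v → Z v → v ∉ X) ×
  (¬ (Σ (Fin (n D)) λ u → Σ (List (Fin (n D))) λ vs → Σ (Fin (n D)) λ z →
        IsWalk (arc D) (u ∷ vs) × All (λ v → v ∉ X) (u ∷ vs) ×
        Z u × last (u ∷ vs) ≡ just z × Z z ×
        Any (λ v → ¬ Z v) (u ∷ vs)))

-- Encoded (standard characterization) as: loopless arc relation, the root
-- has in-degree 0, every other vertex has in-degree exactly 1, and every
-- vertex is reachable from the root by a directed path.

record Arborescence : Set where
  field
    m        : ℕ
    tarc     : Fin m → Fin m → Bool
    root     : Fin m
    tloopless : ∀ t → tarc t t ≡ false
    root-in  : ∣ tabulate (λ s → tarc s root) ∣ ≡ 0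
    other-in : ∀ t → t ≢ root → ∣ tabulate (λ s → tarc s t) ∣ ≡ 1
    reach    : ∀ t → Reachable tarc root t
open Arborescence public

-- Arboreal decompositions of D.  X s t is the guard X_e of the arc
-- e = (s,t) (only meaningful when tarc s t ≡ true).

record ArborealDecomposition (D : Digraph) : Set where
  field
    R        : Arborescence
    X        : Fin (m R) → Fin (m R) → Subset (n D)
    W        : Fin (m R) → Subset (n D)
    W-nonempty : ∀ t → Nonempty (W t)
    W-disjoint : ∀ s t → s ≢ t → ∀ v → v ∈ W s → v ∉ W t
    W-cover    : ∀ v → Σ (Fin (m R)) λ t → v ∈ W t
    normal   : ∀ s t → tarc R s t ≡ true →
               Normal D (X s t) (λ v → Σ (Fin (m R)) λ u → Reachable (tarc R) t u × v ∈ W u)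
open ArborealDecomposition public

bag : {D : Digraph} → (d : ArborealDecomposition D) → Fin (m (R d)) → Subset (n D)
bag d t = W d t ∪ ⋃ (map (λ s → (if tarc (R d) s t then X d s t else ⊥)
                               ∪ (if tarc (R d) t s then X d t s else ⊥))
                         (allFin (m (R d))))

width : {D : Digraph} → ArborealDecomposition D → ℕ
width d = foldr _⊔_ 0 (map (λ t → ∣ bag d t ∣) (allFin (m (R d)))) ∸ 1

-- dtw(D) ≥ k  iff every arboreal decomposition of D has width ≥ k
-- (dtw is the minimum width over all arboreal decompositions)
DtwAtLeast : Digraph → ℕ → Set
DtwAtLeast D k = (d : ArborealDecomposition D) → k Data.Nat.≤ width d

{-# OPTIONS --safe #-}

-- Let k be the largest bag size of an arboreal decomposition and suppose 20k ≤ r. Among the vertex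
-- sets P with |P| ≥ 3k and at most 2kr arcs leaving P pick T of least size; comparing r|T| with the
-- arcs inside and leaving T gives |T| ≥ 12k. For every Y with |Y| ≤ k, a minimal set S closed under
-- out-arcs of D − Y and holding more than a quarter of T has at most kr leaving arcs, so by the
-- minimality of T it misses fewer than 3k vertices of T; as removing a source strong component C of
-- S leaves a closed set, C holds more than half of T. Starting at the root, the component for the
-- current bag meets the previous one, so by normality it lies below a single child; descending
-- forever contradicts acyclicity.

module Submission where

open import Defs
open import Data.Nat using (ℕ; zero; suc; _+_; _*_; _∸_; _/_; _⊔_; _≤_; _<_; z≤n; s≤s)
open import Data.Nat.Properties
open import Data.Nat.DivMod using (m/n*n≤m)
open import Data.Nat.Induction using (<-rec)
open import Data.Nat.Tactic.RingSolver using (solve-∀)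
open import Data.Bool using (Bool; true; false; not; _∧_; if_then_else_)
open import Data.Bool.Properties using (∧-identityʳ; ∧-zeroʳ; ∧-conicalˡ; ∧-conicalʳ; not-injective; ¬-not)
open import Data.Fin as Fin using (Fin; zero; suc)
open import Data.Fin.Subset as Subset using (Subset; _∈_; _∉_; _-_)
open import Data.Fin.Subset.Properties using (∣p∣≤n; p⊆p∪q; q⊆p∪q; x∈p⇒∣p-x∣<∣p∣; x∈p∧x≢y⇒x∈p-y)
open import Data.Vec using (tabulate; lookup)
open import Data.Vec.Properties using (tabulate∘lookup; lookup∘tabulate; lookup⇒[]=; []=⇒lookup)
import Data.List as List
open import Data.List using (List; []; _∷_; last; foldr; allFin)
open import Data.List.Membership.Propositional using () renaming (_∈_ to _∈ₗ_)
open import Data.List.Membership.Propositional.Properties using (∈-allFin)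
import Data.List.Relation.Unary.All as All
open import Data.List.Relation.Unary.All using (All)
open import Data.List.Relation.Unary.Any using (Any; here; there)
open import Data.Maybe using (just)
open import Data.Maybe.Properties using (just-injective)
open import Data.Product using (∃; _×_; _,_; proj₁; proj₂)
open import Data.Sum using (_⊎_; inj₁; inj₂; [_,_]′)
open import Data.Empty using (⊥; ⊥-elim)
open import Function using (_∘_)
open import Relation.Binary.PropositionalEquality using (_≡_; _≢_; refl; sym; trans; cong; cong₂; subst; subst₂)
open import Relation.Nullary using (¬_; Dec; yes; no; does)
open import Relation.Nullary.Decidable using (¬¬-excluded-middle; dec-true; dec-false)
open import Relation.Nullary.Negation using (DoubleNegation)
open import Relation.Binary.Definitions using (Decidable)
open import Algebra.Properties.Semiring.Sum +-*-semiring
  using (sum; sum-cong-≗; sum-replicate-zero; ∑-distrib-+; ∑-comm; *-distribˡ-sum; *-distribʳ-sum)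

open ≤-Reasoning

m≤n/20⇒20*m≤n : ∀ {m n} → m ≤ n / 20 → 20 * m ≤ n
m≤n/20⇒20*m≤n {m} {n} m≤n/20 = begin
  20 * m        ≤⟨ *-monoʳ-≤ 20 m≤n/20 ⟩
  20 * (n / 20) ≡⟨ *-comm 20 (n / 20) ⟩
  n / 20 * 20   ≤⟨ m/n*n≤m n 20 ⟩
  n             ∎

<2*-self : ∀ {t} → 0 < t → t < 2 * t
<2*-self {t} 0<t = subst (t <_) (cong (t +_) (sym (+-identityʳ t))) (m<m+n t 0<t)

<-+-of-halves : ∀ {t a b} → t < 2 * a → t < 2 * b → t < a + b
<-+-of-halves {t} {a} {b} t<2a t<2b = *-cancelˡ-< 2 t (a + b) (begin-strict
  2 * t           ≡⟨ cong (t +_) (+-identityʳ t) ⟩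
  t + t           <⟨ +-mono-< t<2a t<2b ⟩
  2 * a + 2 * b   ≡⟨ *-distribˡ-+ 2 a b ⟨
  2 * (a + b)     ∎)

≤-one-of-two : ∀ {a b c} → a + b ≤ c + c → a ≤ c ⊎ b ≤ c
≤-one-of-two {a} {b} {c} a+b≤c+c with a ≤? c
... | yes a≤c = inj₁ a≤c
... | no a≰c  = inj₂ (≮⇒≥ λ c<b → <⇒≱ (+-mono-< (≰⇒> a≰c) c<b) a+b≤c+c)

quarter-of-rest : ∀ {k a b} → 1 ≤ k → a ≤ k → 12 * k ≤ a + b → a + b < 4 * b
quarter-of-rest {k} {a} {b} 1≤k a≤k 12k≤a+b = begin-strict
  a + b      ≤⟨ +-monoˡ-≤ b a≤k ⟩
  k + b      <⟨ +-monoˡ-< b k<3b ⟩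
  3 * b + b  ≡⟨ +-comm (3 * b) b ⟩
  4 * b      ∎
  where
  11k≤b : 11 * k ≤ b
  11k≤b = +-cancelˡ-≤ k (11 * k) b (≤-trans 12k≤a+b (+-monoˡ-≤ b a≤k))
  k<3b : k < 3 * b
  k<3b = begin-strict
    k                ≡⟨ +-identityʳ k ⟨
    k + 0            <⟨ +-monoʳ-< k (≤-trans 1≤k (m≤n*m k 32)) ⟩
    k + 32 * k       ≡⟨ *-assoc 3 11 k ⟩
    3 * (11 * k)     ≤⟨ *-monoʳ-≤ 3 11k≤b ⟩
    3 * b            ∎

more-than-quarter : ∀ {k t a} → 12 * k ≤ t → t < 4 * a → 3 * k ≤ a
more-than-quarter {k} {t} {a} 12k≤t t<4a =
  <⇒≤ (*-cancelˡ-< 4 (3 * k) a (subst (_< 4 * a) (*-assoc 4 3 k) (≤-<-trans 12k≤t t<4a)))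

majority-of-remainder : ∀ {k t s c b} → s + c + b ≡ t → 4 * s ≤ t → b < 3 * k → 12 * k ≤ t → t < 2 * c
majority-of-remainder {k} {t} {s} {c} {b} s+c+b≡t 4s≤t b<3k 12k≤t =
  *-cancelˡ-< 2 t (2 * c) (+-cancelˡ-< (2 * t) (2 * t) (2 * (2 * c)) (begin-strict
    2 * t + 2 * t            ≡⟨ double-double t ⟩
    4 * t                    ≡⟨ cong (4 *_) s+c+b≡t ⟨
    4 * (s + c + b)          ≡⟨ expand s c b ⟩
    4 * s + 4 * b + 4 * c    <⟨ +-monoˡ-< (4 * c) (+-mono-≤-< 4s≤t 4b<t) ⟩
    t + t + 4 * c            ≡⟨ regroup t c ⟩
    2 * t + 2 * (2 * c)      ∎))
  where
  4b<t : 4 * b < t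
  4b<t = <-≤-trans (subst (4 * b <_) (sym (*-assoc 4 3 k)) (*-monoʳ-< 4 b<3k)) 12k≤t
  double-double : ∀ t → 2 * t + 2 * t ≡ 4 * t
  double-double = solve-∀
  expand : ∀ s c b → 4 * (s + c + b) ≡ 4 * s + 4 * b + 4 * c
  expand = solve-∀
  regroup : ∀ t c → t + t + 4 * c ≡ 2 * t + 2 * (2 * c)
  regroup = solve-∀

2[k*r]+x*x<x*r : ∀ {k r x} → 1 ≤ k → 20 * k ≤ r → 3 * k ≤ x → x < 12 * k → 2 * (k * r) + x * x < x * r
2[k*r]+x*x<x*r {k} {r} {x} 1≤k 20k≤r 3k≤x x<12k =
  subst₂ (λ x r → 2 * (k * r) + x * x < x * r) (m+[n∸m]≡n 3k≤x) (m+[n∸m]≡n 20k≤r)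
         (substituted (x ∸ 3 * k) (r ∸ 20 * k) d≤9k)
  where
  d≤9k : x ∸ 3 * k ≤ 9 * k
  d≤9k = begin
    x ∸ 3 * k           ≤⟨ ∸-monoˡ-≤ (3 * k) (<⇒≤ x<12k) ⟩
    12 * k ∸ 3 * k      ≡⟨ cong (_∸ 3 * k) (*-distribʳ-+ k 9 3) ⟩
    9 * k + 3 * k ∸ 3 * k ≡⟨ m+n∸n≡m (9 * k) (3 * k) ⟩
    9 * k               ∎
  0<k*k : 0 < k * k
  0<k*k = *-mono-≤ 1≤k 1≤k
  substituted : ∀ d e → d ≤ 9 * k →
                2 * (k * (20 * k + e)) + (3 * k + d) * (3 * k + d) < (3 * k + d) * (20 * k + e)
  substituted d e d≤9k = begin-strict
    2 * (k * (20 * k + e)) + (3 * k + d) * (3 * k + d)       ≡⟨ lhs k d e ⟩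
    49 * (k * k) + 6 * (k * d) + 2 * (k * e) + d * d         ≤⟨ +-monoʳ-≤ _ (*-monoˡ-≤ d d≤9k) ⟩
    49 * (k * k) + 6 * (k * d) + 2 * (k * e) + 9 * k * d     ≡⟨ collect k d e ⟩
    49 * (k * k) + 15 * (k * d) + 2 * (k * e)                <⟨ m<m+n _ (<-≤-trans 0<k*k (m≤m+n _ _)) ⟩
    49 * (k * k) + 15 * (k * d) + 2 * (k * e) + (k * k + (10 * (k * k) + 5 * (k * d) + k * e + d * e))
                                                             ≡⟨ rhs k d e ⟩
    (3 * k + d) * (20 * k + e)                               ∎
    where
    lhs : ∀ k d e → 2 * (k * (20 * k + e)) + (3 * k + d) * (3 * k + d)
                  ≡ 49 * (k * k) + 6 * (k * d) + 2 * (k * e) + d * d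
    lhs = solve-∀
    collect : ∀ k d e → 49 * (k * k) + 6 * (k * d) + 2 * (k * e) + 9 * k * d
                      ≡ 49 * (k * k) + 15 * (k * d) + 2 * (k * e)
    collect = solve-∀
    rhs : ∀ k d e → 49 * (k * k) + 15 * (k * d) + 2 * (k * e) + (k * k + (10 * (k * k) + 5 * (k * d) + k * e + d * e))
                  ≡ (3 * k + d) * (20 * k + e)
    rhs = solve-∀

-- Reachability is not shown decidable; since every use ends in ⊥, decisions and minimal elements
-- are taken under double negation.
module _ {X : Set} (Φ : X → Set) (μ : X → ℕ) where

  IsMinimal : X → Set
  IsMinimal y = Φ y × (∀ z → Φ z → μ y ≤ μ z)

  ¬¬-minimal : ∀ x → Φ x → DoubleNegation (∃ IsMinimal)
  ¬¬-minimal x = <-rec Goal step (μ x) x refl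
    where
    Goal : ℕ → Set
    Goal n = ∀ x → μ x ≡ n → Φ x → DoubleNegation (∃ IsMinimal)
    step : ∀ n → (∀ {m} → m < n → Goal m) → Goal n
    step _ below x refl Φx ¬min = ¬¬-excluded-middle {A = ∃ λ z → Φ z × μ z < μ x} λ
      { (yes (z , Φz , z<x)) → below z<x z refl Φz ¬min
      ; (no ¬smaller) → ¬min (x , Φx , λ z Φz → ≮⇒≥ λ z<x → ¬smaller (z , Φz , z<x)) }

¬¬-∀-Fin : ∀ {N} {Q : Fin N → Set} → (∀ i → DoubleNegation (Q i)) → DoubleNegation (∀ i → Q i)
¬¬-∀-Fin {zero}  _   ¬all = ¬all λ ()
¬¬-∀-Fin {suc N} ¬¬Q ¬all =
  ¬¬Q zero λ q₀ → ¬¬-∀-Fin (¬¬Q ∘ suc) λ qₛ → ¬all λ { zero → q₀ ; (suc i) → qₛ i }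

¬¬-decidable : ∀ {N M} (P : Fin N → Fin M → Set) → DoubleNegation (Decidable P)
¬¬-decidable P = ¬¬-∀-Fin λ _ → ¬¬-∀-Fin λ _ → ¬¬-excluded-middle

true≢false : true ≢ false
true≢false ()

does⇒ : ∀ {A : Set} (a? : Dec A) → does a? ≡ true → A
does⇒ (yes a) _ = a

sum-mono-≤ : ∀ {N} {f g : Fin N → ℕ} → (∀ i → f i ≤ g i) → sum f ≤ sum g
sum-mono-≤ {zero}  _   = z≤n
sum-mono-≤ {suc N} f≤g = +-mono-≤ (f≤g zero) (sum-mono-≤ (f≤g ∘ suc))

sum-mono-< : ∀ {N} {f g : Fin N → ℕ} → (∀ i → f i ≤ g i) → ∀ j → f j < g j → sum f < sum g
sum-mono-< f≤g zero    fj<gj = +-mono-<-≤ fj<gj (sum-mono-≤ (f≤g ∘ suc))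
sum-mono-< f≤g (suc j) fj<gj = +-mono-≤-< (f≤g zero) (sum-mono-< (f≤g ∘ suc) j fj<gj)

𝟙 : Bool → ℕ
𝟙 true  = 1
𝟙 false = 0

𝟙-mono : ∀ {p q} → (p ≡ true → q ≡ true) → 𝟙 p ≤ 𝟙 q
𝟙-mono {false} _   = z≤n
𝟙-mono {true}  p⇒q rewrite p⇒q refl = ≤-refl

count : ∀ {N} → (Fin N → Bool) → ℕ
count P = sum (𝟙 ∘ P)

∅ full : ∀ {N} → Fin N → Bool
∅ _    = false
full _ = true

∁ : ∀ {N} → (Fin N → Bool) → Fin N → Bool
∁ P i = not (P i)

infixr 7 _∩_
infixl 6 _∖_
infix 4 _⊆_

_∩_ _∖_ : ∀ {N} → (Fin N → Bool) → (Fin N → Bool) → Fin N → Bool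
(P ∩ Q) i = P i ∧ Q i
(P ∖ Q) i = P i ∧ not (Q i)

_⊆_ : ∀ {N} → (Fin N → Bool) → (Fin N → Bool) → Set
P ⊆ Q = ∀ i → P i ≡ true → Q i ≡ true

module _ {N} (P Q : Fin N → Bool) {i : Fin N} where

  ∩⁺ : P i ≡ true → Q i ≡ true → (P ∩ Q) i ≡ true
  ∩⁺ = cong₂ _∧_

  ∩⁻ : (P ∩ Q) i ≡ true → P i ≡ true × Q i ≡ true
  ∩⁻ PQi = ∧-conicalˡ _ _ PQi , ∧-conicalʳ _ _ PQi

  ∖⁺ : P i ≡ true → Q i ≡ false → (P ∖ Q) i ≡ true
  ∖⁺ Pi Qi = cong₂ _∧_ Pi (cong not Qi)

  ∖⁻ : (P ∖ Q) i ≡ true → P i ≡ true × Q i ≡ false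
  ∖⁻ PQi = ∧-conicalˡ _ _ PQi , not-injective (∧-conicalʳ _ _ PQi)

count-full : ∀ N → count (full {N}) ≡ N
count-full zero    = refl
count-full (suc N) = cong suc (count-full N)

count-mono : ∀ {N} {P Q : Fin N → Bool} → P ⊆ Q → count P ≤ count Q
count-mono P⊆Q = sum-mono-≤ λ i → 𝟙-mono (P⊆Q i)

count-mono-< : ∀ {N} {P Q : Fin N → Bool} → P ⊆ Q → ∀ i → Q i ≡ true → P i ≡ false → count P < count Q
count-mono-< {P = P} {Q} P⊆Q i Qi Pi = sum-mono-< (λ j → 𝟙-mono (P⊆Q j)) i 𝟙Pi<𝟙Qi
  where
  𝟙Pi<𝟙Qi : 𝟙 (P i) < 𝟙 (Q i)
  𝟙Pi<𝟙Qi rewrite Pi | Qi = s≤s z≤n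

count-split : ∀ {N} (P Q : Fin N → Bool) → count P ≡ count (P ∩ Q) + count (P ∖ Q)
count-split P Q = trans (sum-cong-≗ λ i → 𝟙-split (P i) (Q i)) (∑-distrib-+ (𝟙 ∘ (P ∩ Q)) (𝟙 ∘ (P ∖ Q)))
  where
  𝟙-split : ∀ p q → 𝟙 p ≡ 𝟙 (p ∧ q) + 𝟙 (p ∧ not q)
  𝟙-split true  true  = refl
  𝟙-split true  false = refl
  𝟙-split false _     = refl

∑-rows-constant : ∀ {N M} (g : Fin N → ℕ) (h : Fin N → Fin M → ℕ) {r} → (∀ u → sum (h u) ≡ r) →
                  sum (λ u → sum λ w → g u * h u w) ≡ sum g * r
∑-rows-constant g h {r} rows = begin-equality
  sum (λ u → sum λ w → g u * h u w)  ≡⟨ sum-cong-≗ (λ u → *-distribˡ-sum (g u) (h u)) ⟨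
  sum (λ u → g u * sum (h u))        ≡⟨ sum-cong-≗ (λ u → cong (g u *_) (rows u)) ⟩
  sum (λ u → g u * r)                ≡⟨ *-distribʳ-sum r g ⟨
  sum g * r                          ∎

count>0⇒nonempty : ∀ {N} (P : Fin N → Bool) → 0 < count P → ∃ λ i → P i ≡ true
count>0⇒nonempty {suc N} P 0<count with P zero in P₀
... | true  = zero , P₀
... | false = let i , Pi = count>0⇒nonempty (P ∘ suc) 0<count in suc i , Pi

count-tabulate : ∀ {N} (P : Fin N → Bool) → Subset.∣ tabulate P ∣ ≡ count P
count-tabulate {zero}  P = refl
count-tabulate {suc N} P with P zero
... | true  = cong suc (count-tabulate (P ∘ suc))
... | false = count-tabulate (P ∘ suc)

common-element : ∀ {N} (T C C′ : Fin N → Bool) → count T < count (T ∩ C) + count (T ∩ C′) →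
                 ∃ λ i → (T ∩ C ∩ C′) i ≡ true
common-element T C C′ T<T∩C+T∩C′ = count>0⇒nonempty (T ∩ C ∩ C′) (+-cancelˡ-< (count T) 0 _ (begin-strict
  count T + 0                        ≡⟨ +-identityʳ (count T) ⟩
  count T                            <⟨ T<T∩C+T∩C′ ⟩
  count (T ∩ C) + count (T ∩ C′)     ≡⟨ ∑-distrib-+ (𝟙 ∘ (T ∩ C)) (𝟙 ∘ (T ∩ C′)) ⟨
  sum (λ i → 𝟙 ((T ∩ C) i) + 𝟙 ((T ∩ C′) i))
                                     ≤⟨ sum-mono-≤ (λ i → inclusion-exclusion (T i) (C i) (C′ i)) ⟩
  sum (λ i → 𝟙 (T i) + 𝟙 ((T ∩ C ∩ C′) i))
                                     ≡⟨ ∑-distrib-+ (𝟙 ∘ T) (𝟙 ∘ (T ∩ C ∩ C′)) ⟩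
  count T + count (T ∩ C ∩ C′)       ∎))
  where
  inclusion-exclusion : ∀ t c c′ → 𝟙 (t ∧ c) + 𝟙 (t ∧ c′) ≤ 𝟙 t + 𝟙 (t ∧ c ∧ c′)
  inclusion-exclusion false _     _     = z≤n
  inclusion-exclusion true  true  _     = ≤-refl
  inclusion-exclusion true  false false = z≤n
  inclusion-exclusion true  false true  = ≤-refl

∈-tabulate : ∀ {N} (P : Fin N → Bool) {i} → P i ≡ true → i ∈ tabulate P
∈-tabulate P {i} Pi = lookup⇒[]= i (tabulate P) (trans (lookup∘tabulate P i) Pi)

module Tree (A : Arborescence) where

  Node : Set
  Node = Fin (m A)

  infix 4 _⇝_

  _⇝_ : Node → Node → Set
  _⇝_ = Reachable (tarc A)

  ⇝-refl : ∀ t → t ⇝ t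
  ⇝-refl t = [] , single t , refl

  ⇝-prepend : ∀ {s t u} → tarc A s t ≡ true → t ⇝ u → s ⇝ u
  ⇝-prepend {s} {t} st (vs , walk , end) = t ∷ vs , cons s t vs st walk , end

  ⇝-first-arc : ∀ {s u} → s ⇝ u → u ≢ s → ∃ λ c → tarc A s c ≡ true × c ⇝ u
  ⇝-first-arc ([]     , single _ , end)          u≢s = ⊥-elim (u≢s (sym (just-injective end)))
  ⇝-first-arc (c ∷ vs , cons _ _ _ sc walk , end) _   = c , sc , (vs , walk , end)

  ⇝-last-arc : ∀ {s u} → s ⇝ u → u ≡ s ⊎ ∃ λ p → s ⇝ p × tarc A p u ≡ true
  ⇝-last-arc ([]     , single _ , end)          = inj₁ (sym (just-injective end))
  ⇝-last-arc (c ∷ vs , cons _ _ _ sc walk , end) with ⇝-last-arc (vs , walk , end)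
  ... | inj₁ refl           = inj₂ (_ , ⇝-refl _ , sc)
  ... | inj₂ (p , c⇝p , pu) = inj₂ (p , ⇝-prepend sc c⇝p , pu)

  Parents : Node → Subset (m A)
  Parents t = tabulate λ s → tarc A s t

  ∈-Parents : ∀ {s t} → tarc A s t ≡ true → s ∈ Parents t
  ∈-Parents {t = t} = ∈-tabulate (λ s → tarc A s t)

  root-parentless : ∀ s → tarc A s (root A) ≡ false
  root-parentless s with tarc A s (root A) in s→root
  ... | false = refl
  ... | true  = ⊥-elim (n≮0 (subst (Subset.∣ Parents (root A) - s ∣ <_) (root-in A)
                                    (x∈p⇒∣p-x∣<∣p∣ (∈-Parents s→root))))

  parent-unique : ∀ {s s′ t} → t ≢ root A → tarc A s t ≡ true → tarc A s′ t ≡ true → s ≡ s′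
  parent-unique {s} {s′} {t} t≢root st s′t with s Fin.≟ s′
  ... | yes s≡s′ = s≡s′
  ... | no  s≢s′ = ⊥-elim (<-irrefl refl (begin-strict
    1                               ≤⟨ ≤-<-trans z≤n (x∈p⇒∣p-x∣<∣p∣ s∈Parents-s′) ⟩
    Subset.∣ Parents t - s′ ∣       <⟨ x∈p⇒∣p-x∣<∣p∣ (∈-Parents s′t) ⟩
    Subset.∣ Parents t ∣            ≡⟨ other-in A t t≢root ⟩
    1                               ∎))
    where
    s∈Parents-s′ : s ∈ Parents t - s′
    s∈Parents-s′ = x∈p∧x≢y⇒x∈p-y (∈-Parents st) s≢s′

  acyclic : ∀ {a b} → tarc A a b ≡ true → b ⇝ a → ⊥
  acyclic {a} {b} ab b⇝a = off-root (backwards (reach A a) (b⇝a , ⇝-refl a)) refl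
    where
    OnCycle : Node → Set
    OnCycle x = b ⇝ x × x ⇝ a

    parent-on-cycle : ∀ {x} → OnCycle x → ∃ λ y → OnCycle y × tarc A y x ≡ true
    parent-on-cycle {x} (b⇝x , x⇝a) with ⇝-last-arc b⇝x
    ... | inj₁ refl           = a , (b⇝a , ⇝-refl a) , ab
    ... | inj₂ (y , b⇝y , yx) = y , (b⇝y , ⇝-prepend yx x⇝a) , yx

    off-root : ∀ {x} → OnCycle x → x ≢ root A
    off-root on refl = let y , _ , y→root = parent-on-cycle on in
      true≢false (trans (sym y→root) (root-parentless y))

    backwards : ∀ {u x} → u ⇝ x → OnCycle x → OnCycle u
    backwards ([]     , single _ , end)          on = subst OnCycle (sym (just-injective end)) on
    backwards (v ∷ vs , cons _ _ _ uv walk , end) on =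
      let on-v = backwards (vs , walk , end) on
          y , on-y , yv = parent-on-cycle on-v
      in subst OnCycle (parent-unique (off-root on-v) yv uv) on-y

  descendants : Decidable _⇝_ → Node → ℕ
  descendants _⇝?_ t = count λ u → does (t ⇝? u)

  descendants-< : ∀ (_⇝?_ : Decidable _⇝_) {t c} → tarc A t c ≡ true →
                  descendants _⇝?_ c < descendants _⇝?_ t
  descendants-< _⇝?_ {t} {c} tc =
    count-mono-< below-c t (dec-true (t ⇝? t) (⇝-refl t)) (dec-false (c ⇝? t) (acyclic tc))
    where
    below-c : (λ u → does (c ⇝? u)) ⊆ (λ u → does (t ⇝? u))
    below-c u c⇝u = dec-true (t ⇝? u) (⇝-prepend tc (does⇒ (c ⇝? u) c⇝u))

  no-infinite-descent : (P : Node → Set) → (∀ {t} → P t → DoubleNegation (∃ λ c → tarc A t c ≡ true × P c)) →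
                        ∀ t → ¬ P t
  no-infinite-descent P step t Pt = ¬¬-decidable _⇝_ λ _⇝?_ →
    ¬¬-minimal P (descendants _⇝?_) t Pt λ (s , Ps , minimal) →
    step Ps λ (c , sc , Pc) → <⇒≱ (descendants-< _⇝?_ sc) (minimal c Pc)

module Walks (D : Digraph) where

  Vertex : Set
  Vertex = Fin (n D)

  infixr 5 _∷ʷ_

  data Walk (Y : Vertex → Bool) : Vertex → Vertex → Set where
    [_]  : ∀ {a} → Y a ≡ false → Walk Y a a
    _∷ʷ_ : ∀ {a b c} → Y a ≡ false × arc D a b ≡ true → Walk Y b c → Walk Y a c

  module _ {Y : Vertex → Bool} where

    _++ʷ_ : ∀ {a b c} → Walk Y a b → Walk Y b c → Walk Y a c
    [ _ ]     ++ʷ w₂ = w₂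
    (s ∷ʷ w₁) ++ʷ w₂ = s ∷ʷ (w₁ ++ʷ w₂)

    start-avoids : ∀ {a c} → Walk Y a c → Y a ≡ false
    start-avoids [ Ya ]          = Ya
    start-avoids ((Ya , _) ∷ʷ _) = Ya

    tail-vertices : ∀ {a c} → Walk Y a c → List Vertex
    tail-vertices [ _ ]              = []
    tail-vertices (_∷ʷ_ {b = b} _ w) = b ∷ tail-vertices w

    is-walk : ∀ {a c} (w : Walk Y a c) → IsWalk (arc D) (a ∷ tail-vertices w)
    is-walk [ _ ]           = single _
    is-walk ((_ , ab) ∷ʷ w) = cons _ _ (tail-vertices w) ab (is-walk w)

    avoids : ∀ {a c} (w : Walk Y a c) → All (λ v → Y v ≡ false) (a ∷ tail-vertices w)
    avoids [ Ya ]          = Ya All.∷ All.[]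
    avoids ((Ya , _) ∷ʷ w) = Ya All.∷ avoids w

    ends : ∀ {a c} (w : Walk Y a c) → last (a ∷ tail-vertices w) ≡ just c
    ends [ _ ]    = refl
    ends (_ ∷ʷ w) = ends w

    visits-end : ∀ {a c} {P : Vertex → Set} → P c → (w : Walk Y a c) → Any P (a ∷ tail-vertices w)
    visits-end Pc [ _ ]    = here Pc
    visits-end Pc (_ ∷ʷ w) = there (visits-end Pc w)

    visits-++ : ∀ {a b c} {P : Vertex → Set} (w₁ : Walk Y a b) (w₂ : Walk Y b c) →
                Any P (a ∷ tail-vertices w₁) → Any P (a ∷ tail-vertices (w₁ ++ʷ w₂))
    visits-++ _         _  (here Pa)      = here Pa
    visits-++ (_ ∷ʷ w₁) w₂ (there visits) = there (visits-++ w₁ w₂ visits)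

  StronglyConnected : (Vertex → Bool) → (Vertex → Bool) → Set
  StronglyConnected Y C = ∀ {a b} → C a ≡ true → C b ≡ true → Walk Y a b

  strongly-connected-stays-normal :
    ∀ {X Z Y C} → Normal D X Z → (∀ v → Y v ≡ false → v ∉ X) → StronglyConnected Y C →
    ∀ {z} → C z ≡ true → Z z → ∀ {c} → C c ≡ true → DoubleNegation (Z c)
  strongly-connected-stays-normal (_ , no-exit) X⊆Y C-connected {z} Cz Zz {c} Cc ¬Zc =
    no-exit (z , tail-vertices w , z , is-walk w , All.map (X⊆Y _) (avoids w) , Zz , ends w , Zz ,
             visits-++ z→c c→z (visits-end ¬Zc z→c))
    where
    z→c = C-connected Cz Cc
    c→z = C-connected Cc Cz
    w   = z→c ++ʷ c→z

  OutClosed : (Y S : Vertex → Bool) → Set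
  OutClosed Y S = S ⊆ ∁ Y × (∀ {u w} → S u ≡ true → arc D u w ≡ true → Y w ≡ false → S w ≡ true)

  InClosedIn : (S C : Vertex → Bool) → Set
  InClosedIn S C = C ⊆ S × (∀ {u w} → C w ≡ true → S u ≡ true → arc D u w ≡ true → C u ≡ true) ×
                   ∃ (λ v → C v ≡ true)

  module _ {Y S} (S-closed : OutClosed Y S) where

    avoids-Y : ∀ {u} → S u ≡ true → Y u ≡ false
    avoids-Y Su = not-injective (proj₁ S-closed _ Su)

    walk-into-in-closed : ∀ {C} → InClosedIn S C → ∀ {u b} → S u ≡ true → Walk Y u b → C b ≡ true → C u ≡ true
    walk-into-in-closed _                      _  [ _ ]           Cb = Cb
    walk-into-in-closed C-in@(_ , C-closed , _) Su ((_ , uv) ∷ʷ w) Cb =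
      C-closed (walk-into-in-closed C-in (proj₂ S-closed Su uv (start-avoids w)) w Cb) Su uv

    out-closed-∖ : ∀ {C} → InClosedIn S C → OutClosed Y (S ∖ C)
    out-closed-∖ {C} (_ , C-closed , _) = (λ _ S∖Cu → proj₁ S-closed _ (proj₁ (∖⁻ S C S∖Cu))) , leave
      where
      leave : ∀ {u w} → (S ∖ C) u ≡ true → arc D u w ≡ true → Y w ≡ false → (S ∖ C) w ≡ true
      leave S∖Cu uw Yw = let Su , ¬Cu = ∖⁻ S C S∖Cu in
        ∖⁺ S C (proj₂ S-closed Su uw Yw) (¬-not λ Cw → true≢false (trans (sym (C-closed Cw Su uw)) ¬Cu))

    -- If a cannot reach b in D − Y, the vertices of S that can form a smaller in-closed set.
    minimal-in-closed-strongly-connected : ∀ {C} → IsMinimal (InClosedIn S) count C →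
                                           DoubleNegation (StronglyConnected Y C)
    minimal-in-closed-strongly-connected {C} (C-in@(C⊆S , _ , _) , C-minimal) ¬connected =
      ¬¬-decidable (Walk Y) λ walk? → ¬connected (connect walk?)
      where
      connect : Decidable (Walk Y) → StronglyConnected Y C
      connect walk? {a} {b} Ca Cb with walk? a b
      ... | yes a→b = a→b
      ... | no ¬a→b = ⊥-elim (<⇒≱ (count-mono-< Reaching⊆C a Ca a∉Reaching) (C-minimal Reaching Reaching-in-closed))
        where
        Reaches-b : Vertex → Bool
        Reaches-b u = does (walk? u b)

        Reaching : Vertex → Bool
        Reaching = S ∩ Reaches-b

        ∈Reaching⁻ : ∀ {u} → Reaching u ≡ true → S u ≡ true × Walk Y u b
        ∈Reaching⁻ {u} Ru = let Su , u→b = ∩⁻ S Reaches-b Ru in Su , does⇒ (walk? u b) u→b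

        ∈Reaching⁺ : ∀ {u} → S u ≡ true → Walk Y u b → Reaching u ≡ true
        ∈Reaching⁺ {u} Su u→b = ∩⁺ S Reaches-b Su (dec-true (walk? u b) u→b)

        Reaching-in-closed : InClosedIn S Reaching
        Reaching-in-closed =
          (λ _ Ru → proj₁ (∈Reaching⁻ Ru)) ,
          (λ Rw Su uw → ∈Reaching⁺ Su ((avoids-Y Su , uw) ∷ʷ proj₂ (∈Reaching⁻ Rw))) ,
          (b , ∈Reaching⁺ Sb [ avoids-Y Sb ])
          where
          Sb = C⊆S b Cb

        Reaching⊆C : Reaching ⊆ C
        Reaching⊆C u Ru = let Su , u→b = ∈Reaching⁻ Ru in walk-into-in-closed C-in Su u→b Cb

        a∉Reaching : Reaching a ≡ false
        a∉Reaching = ¬-not λ Ra → ¬a→b (proj₂ (∈Reaching⁻ Ra))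

module ArcCounting (D : Digraph) {r : ℕ} (regular : Regular r D) where

  open Walks D

  arcSum : (Vertex → Vertex → ℕ) → ℕ
  arcSum f = sum λ u → sum λ w → 𝟙 (arc D u w) * f u w

  arcSum-split : ∀ {f g h} → (∀ u w → f u w ≡ g u w + h u w) → arcSum f ≡ arcSum g + arcSum h
  arcSum-split {f} {g} {h} f≡g+h = begin-equality
    arcSum f
      ≡⟨ sum-cong-≗ (λ u → sum-cong-≗ λ w → trans (cong (𝟙 (arc D u w) *_) (f≡g+h u w))
                                                   (*-distribˡ-+ (𝟙 (arc D u w)) (g u w) (h u w))) ⟩
    sum (λ u → sum λ w → 𝟙 (arc D u w) * g u w + 𝟙 (arc D u w) * h u w)
      ≡⟨ sum-cong-≗ (λ u → ∑-distrib-+ (λ w → 𝟙 (arc D u w) * g u w) (λ w → 𝟙 (arc D u w) * h u w)) ⟩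
    sum (λ u → sum (λ w → 𝟙 (arc D u w) * g u w) + sum (λ w → 𝟙 (arc D u w) * h u w))
      ≡⟨ ∑-distrib-+ (λ u → sum λ w → 𝟙 (arc D u w) * g u w) (λ u → sum λ w → 𝟙 (arc D u w) * h u w) ⟩
    arcSum g + arcSum h ∎

  arcSum-mono : ∀ {f g} → (∀ u w → arc D u w ≡ true → f u w ≤ g u w) → arcSum f ≤ arcSum g
  arcSum-mono f≤g = sum-mono-≤ λ u → sum-mono-≤ λ w → weighted (arc D u w) (f≤g u w)
    where
    weighted : ∀ a {x y} → (a ≡ true → x ≤ y) → 𝟙 a * x ≤ 𝟙 a * y
    weighted false _   = z≤n
    weighted true  x≤y = *-monoʳ-≤ 1 (x≤y refl)

  out-degree : ∀ u → sum (λ w → 𝟙 (arc D u w)) ≡ r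
  out-degree u = trans (sym (count-tabulate (arc D u))) (proj₁ (regular u))

  in-degree : ∀ w → sum (λ u → 𝟙 (arc D u w)) ≡ r
  in-degree w = trans (sym (count-tabulate λ u → arc D u w)) (proj₂ (regular w))

  arcs : (Vertex → Bool) → (Vertex → Bool) → ℕ
  arcs P Q = arcSum λ u w → 𝟙 (P u ∧ Q w)

  ∂ : (Vertex → Bool) → ℕ
  ∂ P = arcs P (∁ P)

  arcs-from : ∀ P → arcs P full ≡ count P * r
  arcs-from P = trans (sum-cong-≗ λ u → sum-cong-≗ λ w → swap (arc D u w) (P u))
                      (∑-rows-constant (𝟙 ∘ P) (λ u w → 𝟙 (arc D u w)) out-degree)
    where
    swap : ∀ a p → 𝟙 a * 𝟙 (p ∧ true) ≡ 𝟙 p * 𝟙 a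
    swap a p = trans (cong (λ p → 𝟙 a * 𝟙 p) (∧-identityʳ p)) (*-comm (𝟙 a) (𝟙 p))

  arcs-into : ∀ Q → arcs full Q ≡ count Q * r
  arcs-into Q = begin-equality
    arcs full Q                                      ≡⟨ ∑-comm (λ u w → 𝟙 (arc D u w) * 𝟙 (Q w)) ⟩
    sum (λ w → sum λ u → 𝟙 (arc D u w) * 𝟙 (Q w))  ≡⟨ sum-cong-≗ (λ w → sum-cong-≗ λ u → *-comm (𝟙 (arc D u w)) (𝟙 (Q w))) ⟩
    sum (λ w → sum λ u → 𝟙 (Q w) * 𝟙 (arc D u w))  ≡⟨ ∑-rows-constant (𝟙 ∘ Q) (λ w u → 𝟙 (arc D u w)) in-degree ⟩
    count Q * r                                      ∎

  arcs-splitʳ : ∀ P Q → arcs P full ≡ arcs P Q + arcs P (∁ Q)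
  arcs-splitʳ P Q = arcSum-split λ u w → 𝟙-split (P u) (Q w)
    where
    𝟙-split : ∀ p q → 𝟙 (p ∧ true) ≡ 𝟙 (p ∧ q) + 𝟙 (p ∧ not q)
    𝟙-split false _     = refl
    𝟙-split true  true  = refl
    𝟙-split true  false = refl

  arcs-splitˡ : ∀ P Q → arcs full Q ≡ arcs P Q + arcs (∁ P) Q
  arcs-splitˡ P Q = arcSum-split λ u w → 𝟙-split (P u) (Q w)
    where
    𝟙-split : ∀ p q → 𝟙 q ≡ 𝟙 (p ∧ q) + 𝟙 (not p ∧ q)
    𝟙-split true  _ = sym (+-identityʳ _)
    𝟙-split false _ = refl

  ∂-balanced : ∀ S → ∂ S ≡ arcs (∁ S) S
  ∂-balanced S = +-cancelˡ-≡ (arcs S S) _ _ (begin-equality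
    arcs S S + ∂ S          ≡⟨ arcs-splitʳ S S ⟨
    arcs S full             ≡⟨ arcs-from S ⟩
    count S * r             ≡⟨ arcs-into S ⟨
    arcs full S             ≡⟨ arcs-splitˡ S S ⟩
    arcs S S + arcs (∁ S) S ∎)

  arcs-within : ∀ P → arcs P P ≤ count P * count P
  arcs-within P = begin
    arcs P P                                            ≤⟨ sum-mono-≤ (λ u → sum-mono-≤ λ w → drop-arc (arc D u w) (P u) (P w)) ⟩
    sum (λ u → sum λ w → 𝟙 (P u) * 𝟙 (P w))             ≡⟨ ∑-rows-constant (𝟙 ∘ P) (λ _ → 𝟙 ∘ P) (λ _ → refl) ⟩
    count P * count P                                   ∎
    where
    drop-arc : ∀ a p q → 𝟙 a * 𝟙 (p ∧ q) ≤ 𝟙 p * 𝟙 q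
    drop-arc false _     _ = z≤n
    drop-arc true  false _ = z≤n
    drop-arc true  true  _ = ≤-refl

  count*r≤count*count+∂ : ∀ P → count P * r ≤ count P * count P + ∂ P
  count*r≤count*count+∂ P = begin
    count P * r                ≡⟨ arcs-from P ⟨
    arcs P full                ≡⟨ arcs-splitʳ P P ⟩
    arcs P P + ∂ P             ≤⟨ +-monoˡ-≤ (∂ P) (arcs-within P) ⟩
    count P * count P + ∂ P    ∎

  ∂-guarded : ∀ {S Y} → (∀ {u w} → S u ≡ true → S w ≡ false → arc D u w ≡ true → Y w ≡ true) →
              ∂ S ≤ count Y * r
  ∂-guarded {S} {Y} guarded = begin
    ∂ S          ≤⟨ arcSum-mono (λ u w → guarded-arc (S u) (S w) (Y w) (guarded {u} {w})) ⟩
    arcs full Y  ≡⟨ arcs-into Y ⟩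
    count Y * r  ∎
    where
    guarded-arc : ∀ s s′ y {a} → (s ≡ true → s′ ≡ false → a ≡ true → y ≡ true) → a ≡ true →
                  𝟙 (s ∧ not s′) ≤ 𝟙 y
    guarded-arc true false y g a rewrite g refl refl a = ≤-refl
    guarded-arc true true  _ _ _ = z≤n
    guarded-arc false _    _ _ _ = z≤n

  ∂-split : ∀ T S → ∂ (T ∩ S) + ∂ (T ∖ S) ≤ ∂ T + 2 * ∂ S
  ∂-split T S = begin
    ∂ (T ∩ S) + ∂ (T ∖ S)
      ≡⟨ arcSum-split (λ _ _ → refl) ⟨
    arcSum (λ u w → 𝟙 ((T ∩ S) u ∧ ∁ (T ∩ S) w) + 𝟙 ((T ∖ S) u ∧ ∁ (T ∖ S) w))
      ≤⟨ arcSum-mono (λ u w _ → crossing (T u) (S u) (T w) (S w)) ⟩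
    arcSum (λ u w → 𝟙 (T u ∧ not (T w)) + 𝟙 (S u ∧ not (S w)) + 𝟙 (not (S u) ∧ S w))
      ≡⟨ arcSum-split (λ _ _ → refl) ⟩
    arcSum (λ u w → 𝟙 (T u ∧ not (T w)) + 𝟙 (S u ∧ not (S w))) + arcs (∁ S) S
      ≡⟨ cong₂ _+_ (arcSum-split (λ _ _ → refl)) (sym (∂-balanced S)) ⟩
    ∂ T + ∂ S + ∂ S
      ≡⟨ +-assoc (∂ T) (∂ S) (∂ S) ⟩
    ∂ T + (∂ S + ∂ S)
      ≡⟨ cong (λ x → ∂ T + (∂ S + x)) (+-identityʳ (∂ S)) ⟨
    ∂ T + 2 * ∂ S ∎
    where
    -- An arc leaving T ∩ S or T ∖ S leaves T, leaves S or enters S.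
    crossing : ∀ t s t′ s′ → 𝟙 ((t ∧ s) ∧ not (t′ ∧ s′)) + 𝟙 ((t ∧ not s) ∧ not (t′ ∧ not s′))
                           ≤ 𝟙 (t ∧ not t′) + 𝟙 (s ∧ not s′) + 𝟙 (not s ∧ s′)
    crossing false _     _     _     = z≤n
    crossing true  true  true  true  = z≤n
    crossing true  true  true  false = ≤-refl
    crossing true  true  false _     = s≤s z≤n
    crossing true  false true  true  = ≤-refl
    crossing true  false true  false = z≤n
    crossing true  false false _     = s≤s z≤n

  Sparse : ℕ → (Vertex → Bool) → Set
  Sparse k P = ∂ P ≤ 2 * (k * r) × 3 * k ≤ count P

  full-sparse : ∀ {k} → Vertex → 20 * k ≤ r → Sparse k full
  full-sparse {k} v 20k≤r = ∂-full , 3k≤N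
    where
    ∂-full : ∂ full ≤ 2 * (k * r)
    ∂-full = begin
      ∂ full               ≤⟨ ∂-guarded {S = full} {Y = ∅} (λ _ ()) ⟩
      count (∅ {n D}) * r  ≡⟨ cong (_* r) (sum-replicate-zero (n D)) ⟩
      0                    ≤⟨ z≤n ⟩
      2 * (k * r)          ∎
    3k≤N : 3 * k ≤ count (full {n D})
    3k≤N = begin
      3 * k          ≤⟨ *-monoˡ-≤ k (m≤m+n 3 17) ⟩
      20 * k         ≤⟨ 20k≤r ⟩
      r              ≡⟨ proj₁ (regular v) ⟨
      outdeg D v     ≤⟨ ∣p∣≤n (tabulate (arc D v)) ⟩
      n D            ≡⟨ count-full (n D) ⟨
      count (full {n D}) ∎

  sparse⇒large : ∀ {k P} → 1 ≤ k → 20 * k ≤ r → Sparse k P → 12 * k ≤ count P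
  sparse⇒large {k} {P} 1≤k 20k≤r (∂P≤ , 3k≤P) = ≮⇒≥ λ P<12k →
    <⇒≱ (2[k*r]+x*x<x*r 1≤k 20k≤r 3k≤P P<12k) (begin
      count P * r                      ≤⟨ count*r≤count*count+∂ P ⟩
      count P * count P + ∂ P          ≤⟨ +-monoʳ-≤ (count P * count P) ∂P≤ ⟩
      count P * count P + 2 * (k * r)  ≡⟨ +-comm (count P * count P) (2 * (k * r)) ⟩
      2 * (k * r) + count P * count P  ∎)

  no-balanced-cut : ∀ {k T S} → 1 ≤ k → IsMinimal (Sparse k) count T → ∂ S ≤ k * r →
                    3 * k ≤ count (T ∩ S) → 3 * k ≤ count (T ∖ S) → ⊥
  no-balanced-cut {k} {T} {S} 1≤k ((∂T≤ , _) , minimal) ∂S≤ 3k≤in 3k≤out =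
    [ (λ ∂in≤  → <⇒≱ in<T  (minimal (T ∩ S) (∂in≤ , 3k≤in)))
    , (λ ∂out≤ → <⇒≱ out<T (minimal (T ∖ S) (∂out≤ , 3k≤out)))
    ]′ (≤-one-of-two (≤-trans (∂-split T S) (+-mono-≤ ∂T≤ (*-monoʳ-≤ 2 ∂S≤))))
    where
    0<3k : 0 < 3 * k
    0<3k = ≤-trans 1≤k (m≤n*m k 3)
    in<T : count (T ∩ S) < count T
    in<T = subst (count (T ∩ S) <_) (sym (count-split T S)) (m<m+n _ (<-≤-trans 0<3k 3k≤out))
    out<T : count (T ∖ S) < count T
    out<T = subst (count (T ∖ S) <_) (sym (count-split T S)) (m<n+m _ (<-≤-trans 0<3k 3k≤in))

  module _ {k} (1≤k : 1 ≤ k) {T : Vertex → Bool} (T-minimal : IsMinimal (Sparse k) count T)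
           (12k≤T : 12 * k ≤ count T) {Y : Vertex → Bool} (Y≤k : count Y ≤ k) where

    Heavy : (Vertex → Bool) → Set
    Heavy S = count T < 4 * count (T ∩ S)

    HeavyClosed : (Vertex → Bool) → Set
    HeavyClosed S = OutClosed Y S × Heavy S

    ∁Y-heavy-closed : HeavyClosed (∁ Y)
    ∁Y-heavy-closed = ((λ _ ∁Yu → ∁Yu) , (λ _ _ Yw → cong not Yw)) ,
      subst (_< 4 * count (T ∖ Y)) (sym (count-split T Y))
        (quarter-of-rest {k} {count (T ∩ Y)} {count (T ∖ Y)} 1≤k (≤-trans (count-mono {P = T ∩ Y} λ i → proj₂ ∘ ∩⁻ T Y) Y≤k)
                             (subst (12 * k ≤_) (count-split T Y) 12k≤T))

    heavy-in-closed-in-itself : ∀ {S} → Heavy S → InClosedIn S S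
    heavy-in-closed-in-itself {S} S-heavy = (λ _ Su → Su) , (λ _ Su _ → Su) , (i , proj₂ (∩⁻ T S TSi))
      where
      i,TSi = count>0⇒nonempty (T ∩ S) (*-cancelˡ-< 4 0 _ (≤-<-trans z≤n S-heavy))
      i   = proj₁ i,TSi
      TSi = proj₂ i,TSi

    in-closed-core-majority : ∀ {S C} → IsMinimal HeavyClosed count S → InClosedIn S C →
                              count T < 2 * count (T ∩ C)
    in-closed-core-majority {S} {C} ((S-closed , S-heavy) , S-minimal) C-in@(C⊆S , _ , (x , Cx)) =
      <-≤-trans (majority-of-remainder {k} {c = count ((T ∩ S) ∩ C)} decomposition 4[rest]≤T outside<3k 12k≤T)
                (*-monoʳ-≤ 2 (count-mono core⊆T∩C))
      where
      rest-light : 4 * count (T ∩ (S ∖ C)) ≤ count T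
      rest-light = ≮⇒≥ λ rest-heavy →
        <⇒≱ (count-mono-< (λ i → proj₁ ∘ ∖⁻ S C) x (C⊆S x Cx) (trans (cong (λ c → S x ∧ not c) Cx) (∧-zeroʳ (S x))))
            (S-minimal (S ∖ C) (out-closed-∖ S-closed C-in , rest-heavy))

      ∂S≤kr : ∂ S ≤ k * r
      ∂S≤kr = ≤-trans (∂-guarded exit-into-Y) (*-monoˡ-≤ r Y≤k)
        where
        exit-into-Y : ∀ {u w} → S u ≡ true → S w ≡ false → arc D u w ≡ true → Y w ≡ true
        exit-into-Y Su ¬Sw uw = ¬-not λ Yw → true≢false (trans (sym (proj₂ S-closed Su uw Yw)) ¬Sw)

      outside<3k : count (T ∖ S) < 3 * k
      outside<3k = ≰⇒> λ 3k≤outside →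
        no-balanced-cut 1≤k T-minimal ∂S≤kr (more-than-quarter {k} 12k≤T S-heavy) 3k≤outside

      decomposition : count ((T ∩ S) ∖ C) + count ((T ∩ S) ∩ C) + count (T ∖ S) ≡ count T
      decomposition = begin-equality
        count ((T ∩ S) ∖ C) + count ((T ∩ S) ∩ C) + count (T ∖ S)
          ≡⟨ cong (_+ count (T ∖ S)) (+-comm (count ((T ∩ S) ∖ C)) (count ((T ∩ S) ∩ C))) ⟩
        count ((T ∩ S) ∩ C) + count ((T ∩ S) ∖ C) + count (T ∖ S)
          ≡⟨ cong (_+ count (T ∖ S)) (count-split (T ∩ S) C) ⟨
        count (T ∩ S) + count (T ∖ S)
          ≡⟨ count-split T S ⟨
        count T ∎

      4[rest]≤T : 4 * count ((T ∩ S) ∖ C) ≤ count T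
      4[rest]≤T = ≤-trans (*-monoʳ-≤ 4 (count-mono rest⊆T∩[S∖C])) rest-light
        where
        rest⊆T∩[S∖C] : (T ∩ S) ∖ C ⊆ T ∩ (S ∖ C)
        rest⊆T∩[S∖C] i e = let TSi , ¬Ci = ∖⁻ (T ∩ S) C e ; Ti , Si = ∩⁻ T S TSi in
                           ∩⁺ T (S ∖ C) Ti (∖⁺ S C Si ¬Ci)

      core⊆T∩C : (T ∩ S) ∩ C ⊆ T ∩ C
      core⊆T∩C i e = let TSi , Ci = ∩⁻ (T ∩ S) C e in ∩⁺ T C (proj₁ (∩⁻ T S TSi)) Ci

    haven : DoubleNegation (∃ λ C → StronglyConnected Y C × count T < 2 * count (T ∩ C))
    haven ¬haven =
      ¬¬-minimal HeavyClosed count (∁ Y) ∁Y-heavy-closed λ (S , S-minimal@((S-closed , S-heavy) , _)) →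
      ¬¬-minimal (InClosedIn S) count S (heavy-in-closed-in-itself S-heavy) λ (C , C-minimal@(C-in , _)) →
      minimal-in-closed-strongly-connected S-closed C-minimal λ C-connected →
      ¬haven (C , C-connected , in-closed-core-majority S-minimal C-in)

≤-foldr-⊔ : ∀ {A : Set} (f : A → ℕ) {x xs} → x ∈ₗ xs → f x ≤ foldr _⊔_ 0 (List.map f xs)
≤-foldr-⊔ f {xs = y ∷ _}  (here refl) = m≤m⊔n (f y) _
≤-foldr-⊔ f {xs = y ∷ ys} (there x∈ys) = ≤-trans (≤-foldr-⊔ f x∈ys) (m≤n⊔m (f y) _)

⊆-⋃ : ∀ {A : Set} {N} (g : A → Subset N) {a as v} → a ∈ₗ as → v ∈ g a → v ∈ Subset.⋃ (List.map g as)
⊆-⋃ g {as = a ∷ _}  (here refl) v∈ga = p⊆p∪q _ v∈ga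
⊆-⋃ g {as = b ∷ as} (there a∈as) v∈ga = q⊆p∪q (g b) _ (⊆-⋃ g a∈as v∈ga)

module Bags {D : Digraph} (d : ArborealDecomposition D) where

  open Tree (R d) using (Node)

  InBag : Node → Fin (n D) → Bool
  InBag t = lookup (bag d t)

  W⊆bag : ∀ {t v} → v ∈ W d t → InBag t v ≡ true
  W⊆bag v∈W = []=⇒lookup (p⊆p∪q _ v∈W)

  X⊆bag : ∀ {t c v} → tarc (R d) t c ≡ true → v ∈ X d t c → InBag t v ≡ true
  X⊆bag {t} {c} {v} tc v∈X = []=⇒lookup (q⊆p∪q (W d t) _ (⊆-⋃ guards (∈-allFin c) (q⊆p∪q _ _ v∈guard)))
    where
    guards : Node → Subset (n D)
    guards s = (if tarc (R d) s t then X d s t else Subset.⊥) Subset.∪ (if tarc (R d) t s then X d t s else Subset.⊥)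
    v∈guard : v ∈ (if tarc (R d) t c then X d t c else Subset.⊥)
    v∈guard rewrite tc = v∈X

  count-bag : ∀ t → count (InBag t) ≤ suc (width d)
  count-bag t = begin
    count (InBag t)              ≡⟨ count-tabulate (InBag t) ⟨
    Subset.∣ tabulate (InBag t) ∣ ≡⟨ cong Subset.∣_∣ (tabulate∘lookup (bag d t)) ⟩
    Subset.∣ bag d t ∣           ≤⟨ ≤-foldr-⊔ (λ t → Subset.∣ bag d t ∣) (∈-allFin t) ⟩
    largest                      ≤⟨ m≤n+m∸n largest 1 ⟩
    suc (width d)                ∎
    where
    largest = foldr _⊔_ 0 (List.map (λ t → Subset.∣ bag d t ∣) (allFin (m (R d))))

module _ {D : Digraph} {r} (regular : Regular r D) (d : ArborealDecomposition D)
         (20k≤r : 20 * suc (width d) ≤ r) where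

  open Walks D
  open ArcCounting D regular
  open Tree (R d)
  open Bags d

  private
    k : ℕ
    k = suc (width d)

    1≤k : 1 ≤ k
    1≤k = s≤s z≤n

  Below : Node → Vertex → Set
  Below t v = ∃ λ u → t ⇝ u × v ∈ W d u

  Majority : (Vertex → Bool) → Node → Set
  Majority T t = ∃ λ C → count T < 2 * count (T ∩ C) × (∀ {v} → C v ≡ true → DoubleNegation (Below t v))

  module _ {T : Vertex → Bool} (T-minimal : IsMinimal (Sparse k) count T) where

    12k≤T : 12 * k ≤ count T
    12k≤T = sparse⇒large 1≤k 20k≤r (proj₁ T-minimal)

    majority-at-root : Majority T (root (R d))
    majority-at-root = full , T<2[T∩full] , λ {v} _ ¬below →
      let t , v∈Wt = W-cover d v in ¬below (t , reach (R d) t , v∈Wt)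
      where
      T<2[T∩full] : count T < 2 * count (T ∩ full)
      T<2[T∩full] = subst (λ x → count T < 2 * x) (sum-cong-≗ λ i → cong 𝟙 (sym (∧-identityʳ (T i))))
                          (<2*-self (≤-trans (≤-trans 1≤k (m≤n*m k 12)) 12k≤T))

    majority-descends : ∀ {t} → Majority T t → DoubleNegation (∃ λ c → tarc (R d) t c ≡ true × Majority T c)
    majority-descends {t} (C , C-majority , C-below) ¬descends =
      haven 1≤k T-minimal 12k≤T (count-bag t) λ (C′ , C′-connected , C′-majority) →
      let z , TCC′z = common-element T C C′ (<-+-of-halves {a = count (T ∩ C)} {count (T ∩ C′)} C-majority C′-majority)
          _ , CC′z   = ∩⁻ T (C ∩ C′) TCC′z
          Cz , C′z   = ∩⁻ C C′ CC′z
          z∉bag      = start-avoids (C′-connected C′z C′z)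
      -- z lies in some W u with u strictly below t, as z avoids the bag of t; normality of the
      -- subtree at the child c towards u then keeps all of C′ below c.
      in C-below Cz λ (u , t⇝u , z∈Wu) →
      let c , tc , c⇝u = ⇝-first-arc t⇝u λ { refl → true≢false (trans (sym (W⊆bag z∈Wu)) z∉bag) }
          X⊆Y : ∀ v → InBag t v ≡ false → v ∉ X d t c
          X⊆Y v v∉bag v∈X = true≢false (trans (sym (X⊆bag tc v∈X)) v∉bag)
      in ¬descends (c , tc , C′ , C′-majority ,
                    strongly-connected-stays-normal (normal d t c tc) X⊆Y C′-connected C′z (u , c⇝u , z∈Wu))

  no-decomposition : ⊥
  no-decomposition =
    ¬¬-minimal (Sparse k) count full (full-sparse {k} (proj₁ (W-nonempty d (root (R d)))) 20k≤r) λ (T , T-minimal) →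
    no-infinite-descent (Majority T) (majority-descends T-minimal) (root (R d)) (majority-at-root T-minimal)

theorem1p14 : (r : ℕ) (D : Digraph) → Regular r D → DtwAtLeast D (r / 20)
theorem1p14 r D regular d = ≮⇒≥ λ width<r/20 → no-decomposition regular d (m≤n/20⇒20*m≤n width<r/20)
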